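{- Consider a normalized instance of \textsc{Constrained Layer Tree}. Let $c\in\mathbb N^{\lambda+1}$ be a Pareto-optimal relaxed partial solution with $c_0>2$ leaves and branching layer $k$. Then there exist Pareto-optimal relaxed partial solutions $a,b\in\mathbb N^{\lambda+1}$ with $a_0<c_0$ and $b_0<c_0$ leaves such that $a_0\ge\ell_k$, $b_0\ge\ell_k$, and $c$ is the $k$-combination of $a$ and $b$.
   Context: A layer tree with layers $0,\dots,\lambda$ is a rooted tree whose leaves are in layer $0$, with exactly one root in layer $\lambda$, every edge going from a vertex in layer $i-1$ to its parent in layer $i$. The weight $w(v)$ of a vertex is the number of leaves in its subtree. An instance of \textsc{Constrained Layer Tree} is given by nonnegative integers $n_0$ and $(n_i,\ell_i,u_i)_{i\in\{1,\dots,\lambda\}}$, with the convention $\ell_0=u_0=1$. The instance is normalized if $n_i\le n_{i-1}$, $\ell_i\ge\ell_{i-1}$, $u_i\ge u_{i-1}$ for all $i\in\{1,\dots,\lambda\}$. The branching layer of a layer tree (or of a vector $a\in\mathbb N^{\lambda+1}$) is the highest layer $i$ with more than one vertex (resp. $a_i>1$), and $0$ if no such layer exists. A layer tree with branching layer $k$ is almost valid if it has at most $n_i$ vertices in each layer $i$, every vertex $v$ in a layer $i\in\{1,\dots,k\}$ satisfies $\ell_i\le w(v)\le u_i$, and the number of leaves is at most $u_i$ for each $i\in\{k+1,\dots,\lambda\}$. A vector $a=(a_0,\dots,a_\lambda)$ is a relaxed partial solution (with $a_0$ leaves) if there is an almost valid layer tree with exactly $a_i$ vertices in layer $i$ for each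 $i$. For such vectors $a,b$ with branching layers $k_a,k_b$ and $k\in\{\max\{k_a,k_b\},\dots,\lambda\}$, the $k$-combination of $a$ and $b$ is $(a_0+b_0,\dots,a_k+b_k,1,\dots,1)$. For two different relaxed partial solutions $a,b$ with $a_0=b_0$, $a$ dominates $b$ if $a_i\le b_i$ for all $i\in\{1,\dots,\lambda\}$; a relaxed partial solution is Pareto-optimal if no relaxed partial solution dominates it. -}

module Defs where

open import Data.Nat using (ℕ; zero; suc; _+_; _≤_; _<_; _≡ᵇ_; _≤ᵇ_)
open import Data.Bool using (if_then_else_)
open import Data.List using (List; []; _∷_)
open import Data.Fin as Fin using (Fin; toℕ)
open import Data.Vec using (Vec; lookup; tabulate; head)
open import Data.Product using (Σ; _×_; ∃; ∃-syntax; _,_)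
open import Data.Sum using (_⊎_)
open import Data.Unit using (⊤)
open import Relation.Binary.PropositionalEquality using (_≡_; _≢_)
open import Relation.Nullary using (¬_)

-- Instances of Constrained Layer Tree.
-- Λ is the number of layers λ (λ is a keyword in Agda).
-- n i, l i, u i are the data for layer i; only 0 ≤ i ≤ Λ is used for n,
-- only 1 ≤ i ≤ Λ for l, u (layer 0 uses the convention ℓ₀ = u₀ = 1).

record Instance : Set where
  field
    Λ : ℕ
    n : ℕ → ℕ
    l : ℕ → ℕ
    u : ℕ → ℕ
open Instance public

ℓ′ : Instance → ℕ → ℕ
ℓ′ I zero    = 1
ℓ′ I (suc i) = l I (suc i)

u′ : Instance → ℕ → ℕ
u′ I zero    = 1
u′ I (suc i) = u I (suc i)

Normalized : Instance → Set
Normalized I = ∀ i → suc i ≤ Λ I →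
  n I (suc i) ≤ n I i × ℓ′ I i ≤ ℓ′ I (suc i) × u′ I i ≤ u′ I (suc i)

-- Layer trees: a tree whose root is in layer i.  A vertex in layer 0 is a
-- leaf; a vertex in layer i+1 has a nonempty list of children in layer i.

data LTree : ℕ → Set where
  leaf : LTree zero
  node : ∀ {i} → LTree i → List (LTree i) → LTree (suc i)

mutual
  cnt : ∀ {i} → LTree i → ℕ → ℕ
  cnt leaf zero = 1
  cnt leaf (suc j) = 0
  cnt {suc i} (node c cs) j = if j ≡ᵇ suc i then 1 else (cnt c j + cntL cs j)

  cntL : ∀ {i} → List (LTree i) → ℕ → ℕ
  cntL [] j = 0
  cntL (t ∷ ts) j = cnt t j + cntL ts j

w : ∀ {i} → LTree i → ℕ
w t = cnt t 0

mutual
  AllV : (P : (j : ℕ) → LTree j → Set) → ∀ {i} → LTree i → Set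
  AllV P leaf = P zero leaf
  AllV P {suc i} (node c cs) = P (suc i) (node c cs) × AllV P c × AllVL P cs

  AllVL : (P : (j : ℕ) → LTree j → Set) → ∀ {i} → List (LTree i) → Set
  AllVL P [] = ⊤
  AllVL P (t ∷ ts) = AllV P t × AllVL P ts

counts : ∀ {Λ} → LTree Λ → Vec ℕ (suc Λ)
counts t = tabulate (λ i → cnt t (toℕ i))

IsBranchingLayer : ∀ {Λ} → Vec ℕ (suc Λ) → Fin (suc Λ) → Set
IsBranchingLayer a k =
  (∀ i → k Fin.< i → lookup a i ≤ 1) × (toℕ k ≡ 0 ⊎ 1 < lookup a k)

-- almost valid layer tree (its branching layer k is determined by the tree)
AlmostValid : (I : Instance) → LTree (Λ I) → Set
AlmostValid I t = Σ (Fin (suc (Λ I))) λ k →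
  IsBranchingLayer (counts t) k ×
  (∀ (i : Fin (suc (Λ I))) → lookup (counts t) i ≤ n I (toℕ i)) ×
  AllV (λ j v → 1 ≤ j → j ≤ toℕ k → ℓ′ I j ≤ w v × w v ≤ u′ I j) t ×
  (∀ (i : Fin (suc (Λ I))) → k Fin.< i → w t ≤ u′ I (toℕ i))

RelaxedPartialSolution : (I : Instance) → Vec ℕ (suc (Λ I)) → Set
RelaxedPartialSolution I a = Σ (LTree (Λ I)) λ t → AlmostValid I t × counts t ≡ a

Dominates : (I : Instance) → Vec ℕ (suc (Λ I)) → Vec ℕ (suc (Λ I)) → Set
Dominates I a b = a ≢ b × head a ≡ head b ×
  (∀ (i : Fin (Λ I)) → lookup a (Fin.suc i) ≤ lookup b (Fin.suc i))

ParetoOptimal : (I : Instance) → Vec ℕ (suc (Λ I)) → Set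
ParetoOptimal I a = RelaxedPartialSolution I a ×
  ¬ (Σ (Vec ℕ (suc (Λ I))) λ b → RelaxedPartialSolution I b × Dominates I b a)

kComb : ∀ {Λ} → Fin (suc Λ) → Vec ℕ (suc Λ) → Vec ℕ (suc Λ) → Vec ℕ (suc Λ)
kComb k a b = tabulate (λ i → if toℕ i ≤ᵇ toℕ k then lookup a i + lookup b i else 1)

IsKCombination : ∀ {Λ} → Fin (suc Λ) → Vec ℕ (suc Λ) → Vec ℕ (suc Λ) → Vec ℕ (suc Λ) → Set
IsKCombination k a b c =
  (∃[ ka ] ∃[ kb ] IsBranchingLayer a ka × IsBranchingLayer b kb × ka Fin.≤ k × kb Fin.≤ k)
  × c ≡ kComb k a b

{-# OPTIONS --safe #-}
module Submission where

-- Above its branching layer k, a tree T realising c has one vertex per layer, so it is a path ending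
-- in a vertex of layer k + 1 (k < λ since c_k > 1) with at least two children x, y, ys. Re-attaching
-- {x} and {y, ys} to copies of the path gives trees A and B whose count vectors k-combine to c. If A′
-- dominated A, it would again be a path above k, and attaching y, ys below it would give a tree
-- dominating c; so A, and symmetrically B, is Pareto-optimal. Validity survives this cutting and
-- regrafting because, for a normalized instance, almost validity is equivalent to the vertex, weight
-- and leaf bounds taken relative to any layer K above the branching layer, as long as the tree has at
-- least ℓ_K leaves: the vertices between the two layers all carry the full weight.

open import Defs
open import Data.Nat
  using (ℕ; zero; suc; _+_; _≤_; _<_; _≤?_; _<?_; z≤n; s≤s; _≡ᵇ_; _≤ᵇ_; _≤′_; ≤′-refl; ≤′-step)
open import Data.Nat.Properties
open import Data.Bool using (true; false; T; if_then_else_)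
open import Data.List using (List; []; _∷_; _++_)
open import Data.Fin as Fin using (Fin; toℕ; fromℕ<)
open import Data.Fin.Properties using (toℕ-fromℕ<; toℕ-injective; toℕ≤pred[n])
open import Data.Vec using (Vec; _∷_; lookup; head)
open import Data.Vec.Properties using (lookup∘tabulate; tabulate-cong)
open import Data.Vec.Relation.Binary.Pointwise.Extensional using (Pointwise; ext; Pointwise-≡⇒≡)
open import Data.Product using (Σ; ∃; ∃-syntax; _×_; _,_; proj₁; proj₂)
open import Data.Sum using (inj₁; inj₂)
open import Data.Unit using (tt)
open import Relation.Binary.PropositionalEquality
open import Function using (_∘_)
open import Relation.Nullary using (¬_; yes; no; contradiction)

private
  variable
    i j m K : ℕ

cnt-node-≤ : (c : LTree i) (cs : List (LTree i)) → m ≤ i →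
             cnt (node c cs) m ≡ cnt c m + cntL cs m
cnt-node-≤ {i} {m} c cs m≤i with m ≡ᵇ suc i in eq
... | false = refl
... | true  = contradiction (≡ᵇ⇒≡ m (suc i) (subst T (sym eq) tt)) (<⇒≢ (s≤s m≤i))

cnt-root : (t : LTree i) → cnt t i ≡ 1
cnt-root leaf = refl
cnt-root (node {i} c cs) with suc i ≡ᵇ suc i | ≡⇒≡ᵇ (suc i) (suc i) refl
... | true | _ = refl

cnt-positive : (t : LTree i) → m ≤ i → 1 ≤ cnt t m
cnt-positive leaf z≤n = ≤-refl
cnt-positive t@(node c cs) m≤ with m≤n⇒m<n∨m≡n m≤
... | inj₂ refl       = ≤-reflexive (sym (cnt-root t))
... | inj₁ (s≤s m≤i) = begin
  1                       ≤⟨ cnt-positive c m≤i ⟩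
  cnt c _                 ≤⟨ m≤m+n _ _ ⟩
  cnt c _ + cntL cs _     ≡⟨ cnt-node-≤ c cs m≤i ⟨
  cnt t _                 ∎
  where open ≤-Reasoning

cntL-++ : (xs ys : List (LTree i)) (m : ℕ) → cntL (xs ++ ys) m ≡ cntL xs m + cntL ys m
cntL-++ []       ys m = refl
cntL-++ (x ∷ xs) ys m = trans (cong (cnt x m +_) (cntL-++ xs ys m)) (sym (+-assoc (cnt x m) _ _))

cnt-two-children : (c d : LTree i) (ds : List (LTree i)) → 1 < cnt (node c (d ∷ ds)) i
cnt-two-children {i} c d ds = begin-strict
  1                          <⟨ +-mono-≤ (cnt-positive c ≤-refl) (cnt-positive d ≤-refl) ⟩
  cnt c i + cnt d i          ≤⟨ +-monoʳ-≤ (cnt c i) (m≤m+n _ _) ⟩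
  cnt c i + cntL (d ∷ ds) i  ≡⟨ cnt-node-≤ c (d ∷ ds) ≤-refl ⟨
  cnt (node c (d ∷ ds)) i    ∎
  where open ≤-Reasoning

SingleAbove : ℕ → LTree i → Set
SingleAbove {i} K t = ∀ m → K < m → m ≤ i → cnt t m ≤ 1

SingleAbove-child : (c : LTree i) → SingleAbove K (node c []) → SingleAbove K c
SingleAbove-child c single m K<m m≤i =
  subst (_≤ 1) (trans (cnt-node-≤ c [] m≤i) (+-identityʳ _)) (single m K<m (m≤n⇒m≤1+n m≤i))

SingleAbove-cons : (c d : LTree i) (ds : List (LTree i)) → K < i → ¬ SingleAbove K (node c (d ∷ ds))
SingleAbove-cons c d ds K<i single = <⇒≱ (cnt-two-children c d ds) (single _ K<i (n≤1+n _))

Pred : Set₁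
Pred = (j : ℕ) → LTree j → Set

mutual
  AllV-map : {P Q : Pred} → (∀ j v → P j v → Q j v) → (t : LTree i) → AllV P t → AllV Q t
  AllV-map f leaf        p              = f zero leaf p
  AllV-map f (node c cs) (p , pc , pcs) = f _ _ p , AllV-map f c pc , AllVL-map f cs pcs

  AllVL-map : {P Q : Pred} → (∀ j v → P j v → Q j v) →
              (ts : List (LTree i)) → AllVL P ts → AllVL Q ts
  AllVL-map f []       _          = tt
  AllVL-map f (t ∷ ts) (pt , pts) = AllV-map f t pt , AllVL-map f ts pts

mutual
  AllV-zip : {P Q : Pred} (t : LTree i) → AllV P t → AllV Q t → AllV (λ j v → P j v × Q j v) t
  AllV-zip leaf        p              q              = p , q
  AllV-zip (node c cs) (p , pc , pcs) (q , qc , qcs) =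
    (p , q) , AllV-zip c pc qc , AllVL-zip cs pcs qcs

  AllVL-zip : {P Q : Pred} (ts : List (LTree i)) →
              AllVL P ts → AllVL Q ts → AllVL (λ j v → P j v × Q j v) ts
  AllVL-zip []       _          _          = tt
  AllVL-zip (t ∷ ts) (pt , pts) (qt , qts) = AllV-zip t pt qt , AllVL-zip ts pts qts

mutual
  AllV-layer≤ : (t : LTree i) → AllV (λ j _ → j ≤ i) t
  AllV-layer≤ leaf        = z≤n
  AllV-layer≤ (node c cs) =
    ≤-refl ,
    AllV-map (λ _ _ → m≤n⇒m≤1+n) c (AllV-layer≤ c) ,
    AllVL-map (λ _ _ → m≤n⇒m≤1+n) cs (AllVL-layer≤ cs)

  AllVL-layer≤ : (ts : List (LTree i)) → AllVL (λ j _ → j ≤ i) ts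
  AllVL-layer≤ []       = tt
  AllVL-layer≤ (t ∷ ts) = AllV-layer≤ t , AllVL-layer≤ ts

AllV-root : {P : Pred} (t : LTree i) → AllV P t → P i t
AllV-root leaf        p       = p
AllV-root (node c cs) (p , _) = p

AllV⇒∃-layer : {P : Pred} (t : LTree i) → m ≤ i → AllV P t → Σ (LTree m) (P m)
AllV⇒∃-layer leaf        z≤n p = leaf , p
AllV⇒∃-layer (node c cs) m≤  (p , pc , _) with m≤n⇒m<n∨m≡n m≤
... | inj₂ refl       = node c cs , p
... | inj₁ (s≤s m≤i) = AllV⇒∃-layer c m≤i pc

AllVL-++ : {P : Pred} (xs ys : List (LTree i)) → AllVL P xs → AllVL P ys → AllVL P (xs ++ ys)
AllVL-++ []       ys _          pys = pys
AllVL-++ (x ∷ xs) ys (px , pxs) pys = px , AllVL-++ xs ys pxs pys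

AllV-vacuous-above : {P : Pred} (t : LTree i) → i ≤ K → AllV (λ j v → K < j → P j v) t
AllV-vacuous-above t i≤K =
  AllV-map (λ j v j≤i K<j → contradiction (≤-trans j≤i i≤K) (<⇒≱ K<j)) t (AllV-layer≤ t)

AllVL-vacuous-above : {P : Pred} (ts : List (LTree i)) → i ≤ K → AllVL (λ j v → K < j → P j v) ts
AllVL-vacuous-above ts i≤K =
  AllVL-map (λ j v j≤i K<j → contradiction (≤-trans j≤i i≤K) (<⇒≱ K<j)) ts (AllVL-layer≤ ts)

weight-above : (t : LTree i) → SingleAbove K t → AllV (λ j v → K < j → w v ≡ w t) t
weight-above leaf _ = λ ()
weight-above {K = K} (node {i} c cs) single with K <? i
... | no K≮i =
  (λ _ → refl) , AllV-vacuous-above c (≮⇒≥ K≮i) , AllVL-vacuous-above cs (≮⇒≥ K≮i)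
weight-above (node c [])       single | yes _ =
  (λ _ → refl) ,
  AllV-map (λ j v w≡ K<j → trans (w≡ K<j) (sym (+-identityʳ _))) c
    (weight-above c (SingleAbove-child c single)) ,
  tt
weight-above (node c (d ∷ ds)) single | yes K<i = contradiction single (SingleAbove-cons c d ds K<i)

lift : j ≤′ i → LTree j → LTree i
lift ≤′-refl      t = t
lift (≤′-step h) t = node (lift h t) []

cnt-lift-≤ : (h : j ≤′ i) (t : LTree j) → m ≤ j → cnt (lift h t) m ≡ cnt t m
cnt-lift-≤ ≤′-refl      t m≤j = refl
cnt-lift-≤ (≤′-step h) t m≤j =
  trans (cnt-node-≤ (lift h t) [] (≤-trans m≤j (≤′⇒≤ h)))
        (trans (+-identityʳ _) (cnt-lift-≤ h t m≤j))

cnt-lift-> : (h : j ≤′ i) (t : LTree j) → j < m → m ≤ i → cnt (lift h t) m ≡ 1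
cnt-lift-> ≤′-refl      t j<m m≤j = contradiction m≤j (<⇒≱ j<m)
cnt-lift-> (≤′-step h) t j<m m≤ with m≤n⇒m<n∨m≡n m≤
... | inj₂ refl       = cnt-root (lift (≤′-step h) t)
... | inj₁ (s≤s m≤i) =
  trans (cnt-node-≤ (lift h t) [] m≤i) (trans (+-identityʳ _) (cnt-lift-> h t j<m m≤i))

AllV-lift⁻ : {P : Pred} (h : j ≤′ i) (t : LTree j) → AllV P (lift h t) → AllV P t
AllV-lift⁻ ≤′-refl      t p           = p
AllV-lift⁻ (≤′-step h) t (_ , p , _) = AllV-lift⁻ h t p

AllV-lift⁺ : {P : Pred} → (∀ m v → j < m → P m v) →
             (h : j ≤′ i) (t : LTree j) → AllV P t → AllV P (lift h t)
AllV-lift⁺ above ≤′-refl      t p = p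
AllV-lift⁺ above (≤′-step h) t p = above _ _ (s≤s (≤′⇒≤ h)) , AllV-lift⁺ above h t p , tt

SingleAbove⇒lift : (h : suc K ≤′ i) (t : LTree i) → SingleAbove K t → ∃ λ t′ → t ≡ lift h t′
SingleAbove⇒lift ≤′-refl      t                 _      = t , refl
SingleAbove⇒lift (≤′-step h) (node c [])       single
  with SingleAbove⇒lift h c (SingleAbove-child c single)
... | t′ , refl = t′ , refl
SingleAbove⇒lift (≤′-step h) (node c (d ∷ ds)) single =
  contradiction single (SingleAbove-cons c d ds (≤′⇒≤ h))

AtMostOneAbove : ∀ {L} → ℕ → Vec ℕ (suc L) → Set
AtMostOneAbove K a = ∀ x → K < toℕ x → lookup a x ≤ 1

module _ {L : ℕ} where

  ∀Fin⇒∀≤ : (P : ℕ → Set) → (∀ (x : Fin (suc L)) → P (toℕ x)) → m ≤ L → P m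
  ∀Fin⇒∀≤ P all m≤L = subst P (toℕ-fromℕ< (s≤s m≤L)) (all (fromℕ< (s≤s m≤L)))

  lookup-counts : (t : LTree L) (x : Fin (suc L)) → lookup (counts t) x ≡ cnt t (toℕ x)
  lookup-counts t = lookup∘tabulate (λ x → cnt t (toℕ x))

  counts-≤ : (s t : LTree L) → Pointwise _≤_ (counts s) (counts t) → m ≤ L → cnt s m ≤ cnt t m
  counts-≤ s t s≤t =
    ∀Fin⇒∀≤ (λ m → cnt s m ≤ cnt t m)
      (λ x → subst₂ _≤_ (lookup-counts s x) (lookup-counts t x) (Pointwise.app s≤t x))

  SingleAbove-≤ : (s t : LTree L) → Pointwise _≤_ (counts s) (counts t) →
                  SingleAbove K t → SingleAbove K s
  SingleAbove-≤ s t s≤t single m K<m m≤L = ≤-trans (counts-≤ s t s≤t m≤L) (single m K<m m≤L)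

  SingleAbove⇒AtMostOneAbove : (t : LTree L) → SingleAbove K t → AtMostOneAbove K (counts t)
  SingleAbove⇒AtMostOneAbove t single x K<x =
    subst (_≤ 1) (sym (lookup-counts t x)) (single (toℕ x) K<x (toℕ≤pred[n] x))

  AtMostOneAbove⇒SingleAbove : (t : LTree L) → AtMostOneAbove K (counts t) → SingleAbove K t
  AtMostOneAbove⇒SingleAbove {K} t ones m K<m m≤L =
    ∀Fin⇒∀≤ (λ m → K < m → cnt t m ≤ 1) (λ x → subst (_≤ 1) (lookup-counts t x) ∘ ones x)
      m≤L K<m

  branchingLayer-≤ : (a : Vec ℕ (suc L)) {k : Fin (suc L)} →
                     AtMostOneAbove K a → IsBranchingLayer a k → toℕ k ≤ K
  branchingLayer-≤ a ones (_ , inj₁ k≡0)  = subst (_≤ _) (sym k≡0) z≤n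
  branchingLayer-≤ a ones (_ , inj₂ 1<aₖ) = ≮⇒≥ (λ K<k → <⇒≱ 1<aₖ (ones _ K<k))

  branchingLayer-unique : (a : Vec ℕ (suc L)) {k k′ : Fin (suc L)} →
                          IsBranchingLayer a k → IsBranchingLayer a k′ → toℕ k ≡ toℕ k′
  branchingLayer-unique a bl bl′ =
    ≤-antisym (branchingLayer-≤ a (proj₁ bl′) bl) (branchingLayer-≤ a (proj₁ bl) bl′)

  branchingLayer-below : (a : Vec ℕ (suc L)) → m ≤ L → AtMostOneAbove m a → ∃ (IsBranchingLayer a)
  branchingLayer-below {zero}  a _   ones = Fin.zero , ones , inj₁ refl
  branchingLayer-below {suc m} a m<L ones = candidate (fromℕ< (s≤s m<L)) (toℕ-fromℕ< (s≤s m<L))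
    where
    candidate : (x : Fin (suc L)) → toℕ x ≡ suc m → ∃ (IsBranchingLayer a)
    candidate x x≡ with lookup a x ≤? 1
    ... | no  aₓ≰1 = x , (λ y x<y → ones y (subst (_< toℕ y) x≡ x<y)) , inj₂ (≰⇒> aₓ≰1)
    ... | yes aₓ≤1 = branchingLayer-below a (<⇒≤ m<L) onesFrom-x
      where
      onesFrom-x : AtMostOneAbove m a
      onesFrom-x y m<y with m≤n⇒m<n∨m≡n m<y
      ... | inj₁ x<y = ones y x<y
      ... | inj₂ x≡y = subst (λ z → lookup a z ≤ 1) (toℕ-injective (trans x≡ x≡y)) aₓ≤1

  branchingLayer : (a : Vec ℕ (suc L)) → ∃ (IsBranchingLayer a)
  branchingLayer a =
    branchingLayer-below a ≤-refl (λ x L<x → contradiction (toℕ≤pred[n] x) (<⇒≱ L<x))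

  branchingLayer-nontrivial : (a : Vec ℕ (suc L)) {k : Fin (suc L)} →
                              1 < head a → IsBranchingLayer a k → 1 < lookup a k
  branchingLayer-nontrivial (_ ∷ _) {Fin.zero}  1<a₀ _               = 1<a₀
  branchingLayer-nontrivial (_ ∷ _) {Fin.suc k} _    (_ , inj₂ 1<aₖ) = 1<aₖ

  module _ (k : Fin (suc L)) where

    lookup-kComb : (a b : Vec ℕ (suc L)) (x : Fin (suc L)) →
                   lookup (kComb k a b) x ≡ (if toℕ x ≤ᵇ toℕ k then lookup a x + lookup b x else 1)
    lookup-kComb a b = lookup∘tabulate _

    lookup-kComb-≤ : (a b : Vec ℕ (suc L)) {x : Fin (suc L)} → toℕ x ≤ toℕ k →
                     lookup (kComb k a b) x ≡ lookup a x + lookup b x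
    lookup-kComb-≤ a b {x} x≤k with toℕ x ≤ᵇ toℕ k | ≤⇒≤ᵇ x≤k | lookup-kComb a b x
    ... | true | _ | eq = eq

    lookup-kComb-> : (a b : Vec ℕ (suc L)) {x : Fin (suc L)} → toℕ k < toℕ x →
                     lookup (kComb k a b) x ≡ 1
    lookup-kComb-> a b {x} k<x with toℕ x ≤ᵇ toℕ k | ≤ᵇ⇒≤ (toℕ x) (toℕ k) | lookup-kComb a b x
    ... | false | _   | eq = eq
    ... | true  | x≤k | _  = contradiction (x≤k tt) (<⇒≱ k<x)

    head-kComb : (a b : Vec ℕ (suc L)) → head (kComb k a b) ≡ head a + head b
    head-kComb (_ ∷ _) (_ ∷ _) = refl

    kComb-comm : (a b : Vec ℕ (suc L)) → kComb k a b ≡ kComb k b a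
    kComb-comm a b = tabulate-cong λ x →
      cong (λ s → if toℕ x ≤ᵇ toℕ k then s else 1) (+-comm (lookup a x) (lookup b x))

    kComb-≥ˡ : (a b : Vec ℕ (suc L)) → AtMostOneAbove (toℕ k) a → Pointwise _≤_ a (kComb k a b)
    kComb-≥ˡ a b ones = ext λ x → case-≤ x
      where
      case-≤ : ∀ x → lookup a x ≤ lookup (kComb k a b) x
      case-≤ x with toℕ x ≤? toℕ k
      ... | yes x≤k = subst (lookup a x ≤_) (sym (lookup-kComb-≤ a b x≤k)) (m≤m+n _ _)
      ... | no  x≰k = subst (lookup a x ≤_) (sym (lookup-kComb-> a b (≰⇒> x≰k))) (ones x (≰⇒> x≰k))

    kComb-monoˡ : {a′ a : Vec ℕ (suc L)} (b : Vec ℕ (suc L)) →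
                  Pointwise _≤_ a′ a → Pointwise _≤_ (kComb k a′ b) (kComb k a b)
    kComb-monoˡ {a′} {a} b a′≤a = ext λ x → case-≤ x
      where
      case-≤ : ∀ x → lookup (kComb k a′ b) x ≤ lookup (kComb k a b) x
      case-≤ x with toℕ x ≤? toℕ k
      ... | yes x≤k = subst₂ _≤_ (sym (lookup-kComb-≤ a′ b x≤k)) (sym (lookup-kComb-≤ a b x≤k))
                        (+-monoˡ-≤ (lookup b x) (Pointwise.app a′≤a x))
      ... | no  x≰k =
        ≤-reflexive (trans (lookup-kComb-> a′ b (≰⇒> x≰k)) (sym (lookup-kComb-> a b (≰⇒> x≰k))))

    kComb-cancelʳ : {a′ a : Vec ℕ (suc L)} (b : Vec ℕ (suc L)) →
                    (∀ x → toℕ k < toℕ x → lookup a′ x ≡ lookup a x) →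
                    kComb k a′ b ≡ kComb k a b → a′ ≡ a
    kComb-cancelʳ {a′} {a} b agree eq = Pointwise-≡⇒≡ (ext case-≡)
      where
      case-≡ : ∀ x → lookup a′ x ≡ lookup a x
      case-≡ x with toℕ x ≤? toℕ k
      ... | no  x≰k = agree x (≰⇒> x≰k)
      ... | yes x≤k = +-cancelʳ-≡ (lookup b x) _ _ (begin
        lookup a′ x + lookup b x   ≡⟨ lookup-kComb-≤ a′ b x≤k ⟨
        lookup (kComb k a′ b) x    ≡⟨ cong (λ c → lookup c x) eq ⟩
        lookup (kComb k a b) x     ≡⟨ lookup-kComb-≤ a b x≤k ⟩
        lookup a x + lookup b x    ∎)
        where open ≡-Reasoning

module _ (I : Instance) where

  Dominates⇒≤ : {a b : Vec ℕ (suc (Λ I))} → Dominates I a b → Pointwise _≤_ a b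
  Dominates⇒≤ {_ ∷ _} {_ ∷ _} (_ , a₀≡b₀ , tail≤) =
    ext λ { Fin.zero → ≤-reflexive a₀≡b₀ ; (Fin.suc x) → tail≤ x }

  kComb-dominatesˡ : (k : Fin (suc (Λ I))) {a′ a : Vec ℕ (suc (Λ I))} (b : Vec ℕ (suc (Λ I))) →
                     (∀ x → toℕ k < toℕ x → lookup a′ x ≡ lookup a x) →
                     Dominates I a′ a → Dominates I (kComb k a′ b) (kComb k a b)
  kComb-dominatesˡ k {a′} {a} b agree a′≻a@(a′≢a , a′₀≡a₀ , _) =
    a′≢a ∘ kComb-cancelʳ k b agree ,
    trans (head-kComb k a′ b) (trans (cong (_+ head b) a′₀≡a₀) (sym (head-kComb k a b))) ,
    Pointwise.app (kComb-monoˡ k b (Dominates⇒≤ a′≻a)) ∘ Fin.suc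

  Undominated : Vec ℕ (suc (Λ I)) → Set
  Undominated c = ¬ (Σ (Vec ℕ (suc (Λ I))) λ b → RelaxedPartialSolution I b × Dominates I b c)

  ℓ′-mono : Normalized I → j ≤ K → K ≤ Λ I → ℓ′ I j ≤ ℓ′ I K
  ℓ′-mono {K = zero}  N z≤n _   = ≤-refl
  ℓ′-mono {K = suc K} N j≤ K<L with m≤n⇒m<n∨m≡n j≤
  ... | inj₂ refl       = ≤-refl
  ... | inj₁ (s≤s j≤K) = ≤-trans (ℓ′-mono N j≤K (<⇒≤ K<L)) (proj₁ (proj₂ (N K K<L)))

  WeightBounded : ℕ → Pred
  WeightBounded K j v = 1 ≤ j → j ≤ K → ℓ′ I j ≤ w v × w v ≤ u′ I j

  record AlmostValidAt (K : ℕ) (t : LTree (Λ I)) : Set where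
    field
      vertexBound : ∀ x → lookup (counts t) x ≤ n I (toℕ x)
      weightBound : AllV (WeightBounded K) t
      leafBound   : (x : Fin (suc (Λ I))) → K < toℕ x → w t ≤ u′ I (toℕ x)

  WeightBounded-root : (v : LTree K) → AllV (WeightBounded K) v → ℓ′ I K ≤ w v
  WeightBounded-root {zero}  v _  = cnt-positive v z≤n
  WeightBounded-root {suc K} v wb = proj₁ (AllV-root v wb (s≤s z≤n) ≤-refl)

  WeightBounded-above : (v : LTree j) → K < j → WeightBounded K j v
  WeightBounded-above v K<j _ j≤K = contradiction j≤K (<⇒≱ K<j)

  AlmostValid⇒AlmostValidAt-branching : {t : LTree (Λ I)} {k : Fin (suc (Λ I))} →
    AlmostValid I t → IsBranchingLayer (counts t) k → AlmostValidAt (toℕ k) t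
  AlmostValid⇒AlmostValidAt-branching {t} (kt , blt , vb , wb , lb) bl =
    subst (λ K → AlmostValidAt K t) (branchingLayer-unique (counts t) blt bl)
      (record { vertexBound = vb ; weightBound = wb ; leafBound = lb })

  AlmostValid⇒AlmostValidAt : Normalized I → {t : LTree (Λ I)} →
    AlmostValid I t → SingleAbove K t → K ≤ Λ I → ℓ′ I K ≤ w t → AlmostValidAt K t
  AlmostValid⇒AlmostValidAt {K} N {t} (kt , blt , vb , wb , lb) single K≤L ℓK≤wt = record
    { vertexBound = vb
    ; weightBound = AllV-map bounded t (AllV-zip t wb (AllV-zip t fullWeight (AllV-layer≤ t)))
    ; leafBound   = λ x K<x → lb x (≤-<-trans kt≤K K<x)
    }
    where
    kt≤K : toℕ kt ≤ K
    kt≤K = branchingLayer-≤ (counts t) (SingleAbove⇒AtMostOneAbove t single) blt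
    fullWeight : AllV (λ j v → toℕ kt < j → w v ≡ w t) t
    fullWeight = weight-above t (AtMostOneAbove⇒SingleAbove t (proj₁ blt))
    bounded : ∀ j v → WeightBounded (toℕ kt) j v × (toℕ kt < j → w v ≡ w t) × j ≤ Λ I →
              WeightBounded K j v
    bounded j v (wbv , w≡ , j≤L) 1≤j j≤K with j ≤? toℕ kt
    ... | yes j≤kt = wbv 1≤j j≤kt
    ... | no  j≰kt = subst (λ s → ℓ′ I j ≤ s × s ≤ u′ I j) (sym (w≡ (≰⇒> j≰kt)))
                       (≤-trans (ℓ′-mono N j≤K K≤L) ℓK≤wt ,
                        ∀Fin⇒∀≤ (λ j → toℕ kt < j → w t ≤ u′ I j) lb j≤L (≰⇒> j≰kt))

  AlmostValidAt⇒AlmostValid : {t : LTree (Λ I)} → AlmostValidAt K t → SingleAbove K t → AlmostValid I t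
  AlmostValidAt⇒AlmostValid {K} {t} valid single with branchingLayer (counts t)
  ... | kt , blt =
    kt , blt , vertexBound , AllV-map (λ j v wbv 1≤j j≤kt → wbv 1≤j (≤-trans j≤kt kt≤K)) t weightBound ,
    leafBound′
    where
    open AlmostValidAt valid
    kt≤K : toℕ kt ≤ K
    kt≤K = branchingLayer-≤ (counts t) (SingleAbove⇒AtMostOneAbove t single) blt
    fullWeight : AllV (λ j v → toℕ kt < j → w v ≡ w t) t
    fullWeight = weight-above t (AtMostOneAbove⇒SingleAbove t (proj₁ blt))
    leafBound′ : ∀ x → kt Fin.< x → w t ≤ u′ I (toℕ x)
    leafBound′ x kt<x with K <? toℕ x
    ... | yes K<x = leafBound x K<x
    ... | no  K≮x with AllV⇒∃-layer t (toℕ≤pred[n] x) (AllV-zip t weightBound fullWeight)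
    ...   | v , wbv , w≡ =
      subst (_≤ u′ I (toℕ x)) (w≡ kt<x) (proj₂ (wbv (≤-trans (s≤s z≤n) kt<x) (≮⇒≥ K≮x)))

  AlmostValidAt-mono : (s : LTree (Λ I)) {t : LTree (Λ I)} →
                       AlmostValidAt K t → Pointwise _≤_ (counts s) (counts t) →
                       AllV (WeightBounded K) s → AlmostValidAt K s
  AlmostValidAt-mono s valid s≤t wb = record
    { vertexBound = λ x → ≤-trans (Pointwise.app s≤t x) (vertexBound x)
    ; weightBound = wb
    ; leafBound   = λ x K<x → ≤-trans (Pointwise.app s≤t Fin.zero) (leafBound x K<x)
    }
    where open AlmostValidAt valid

  ParetoSplit : Fin (suc (Λ I)) → Vec ℕ (suc (Λ I)) → Set
  ParetoSplit k c = Σ (Vec ℕ (suc (Λ I))) λ a → Σ (Vec ℕ (suc (Λ I))) λ b →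
    ParetoOptimal I a × ParetoOptimal I b ×
    head a < head c × head b < head c ×
    ℓ′ I (toℕ k) ≤ head a × ℓ′ I (toℕ k) ≤ head b ×
    IsKCombination k a b c

module Graft (I : Instance) (N : Normalized I) (k : Fin (suc (Λ I))) (h : suc (toℕ k) ≤′ Λ I) where

  LTreeₖ : Set
  LTreeₖ = LTree (toℕ k)

  Boundedₖ : Pred
  Boundedₖ = WeightBounded I (toℕ k)

  graft : LTreeₖ → List LTreeₖ → LTree (Λ I)
  graft p ps = lift h (node p ps)

  cnt-graft-≤ : ∀ p ps → m ≤ toℕ k → cnt (graft p ps) m ≡ cnt p m + cntL ps m
  cnt-graft-≤ p ps m≤k = trans (cnt-lift-≤ h _ (m≤n⇒m≤1+n m≤k)) (cnt-node-≤ p ps m≤k)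

  cnt-graft-> : ∀ p ps → toℕ k < m → m ≤ Λ I → cnt (graft p ps) m ≡ 1
  cnt-graft-> p ps k<m m≤L with m≤n⇒m<n∨m≡n k<m
  ... | inj₂ refl  = trans (cnt-lift-≤ h _ ≤-refl) (cnt-root (node p ps))
  ... | inj₁ k+1<m = cnt-lift-> h _ k+1<m m≤L

  lookup-counts-graft-> : ∀ p ps {x} → toℕ k < toℕ x → lookup (counts (graft p ps)) x ≡ 1
  lookup-counts-graft-> p ps {x} k<x =
    trans (lookup-counts (graft p ps) x) (cnt-graft-> p ps k<x (toℕ≤pred[n] x))

  SingleAbove-graft : ∀ p ps → SingleAbove (toℕ k) (graft p ps)
  SingleAbove-graft p ps m k<m m≤L = ≤-reflexive (cnt-graft-> p ps k<m m≤L)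

  AllV-graft⁻ : {P : Pred} → ∀ p ps → AllV P (graft p ps) → AllV P p × AllVL P ps
  AllV-graft⁻ p ps all = proj₂ (AllV-lift⁻ h (node p ps) all)

  AllV-graft⁺ : ∀ p ps → AllV Boundedₖ p → AllVL Boundedₖ ps → AllV Boundedₖ (graft p ps)
  AllV-graft⁺ p ps wp wps =
    AllV-lift⁺ {P = Boundedₖ} (λ _ v → WeightBounded-above I v ∘ <⇒≤) h (node p ps)
      (WeightBounded-above I (node p ps) ≤-refl , wp , wps)

  graft-weight-≥ : ∀ p ps → AllV Boundedₖ (graft p ps) → ℓ′ I (toℕ k) ≤ w (graft p ps)
  graft-weight-≥ p ps wb = begin
    ℓ′ I (toℕ k)     ≤⟨ WeightBounded-root I p (proj₁ (AllV-graft⁻ p ps wb)) ⟩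
    w p              ≤⟨ m≤m+n (w p) (cntL ps 0) ⟩
    w p + cntL ps 0  ≡⟨ cnt-graft-≤ p ps z≤n ⟨
    w (graft p ps)   ∎
    where open ≤-Reasoning

  graft-branchingLayer : ∀ p ps →
    Σ (Fin (suc (Λ I))) λ kA → IsBranchingLayer (counts (graft p ps)) kA × kA Fin.≤ k
  graft-branchingLayer p ps with branchingLayer (counts (graft p ps))
  ... | kA , bl = kA , bl , branchingLayer-≤ (counts (graft p ps))
                              (SingleAbove⇒AtMostOneAbove (graft p ps) (SingleAbove-graft p ps)) bl

  counts-graft-++ : ∀ p ps q qs →
    counts (graft p (ps ++ q ∷ qs)) ≡ kComb k (counts (graft p ps)) (counts (graft q qs))
  counts-graft-++ p ps q qs = Pointwise-≡⇒≡ (ext case-≡)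
    where
    A = counts (graft p ps)
    B = counts (graft q qs)
    case-≡ : ∀ x → lookup (counts (graft p (ps ++ q ∷ qs))) x ≡ lookup (kComb k A B) x
    case-≡ x with toℕ x ≤? toℕ k
    ... | no  x≰k = trans (lookup-counts-graft-> p (ps ++ q ∷ qs) (≰⇒> x≰k))
                          (sym (lookup-kComb-> k A B (≰⇒> x≰k)))
    ... | yes x≤k = begin
      lookup (counts (graft p (ps ++ q ∷ qs))) x     ≡⟨ lookup-counts (graft p (ps ++ q ∷ qs)) x ⟩
      cnt (graft p (ps ++ q ∷ qs)) y                 ≡⟨ cnt-graft-≤ p (ps ++ q ∷ qs) x≤k ⟩
      cnt p y + cntL (ps ++ q ∷ qs) y                ≡⟨ cong (cnt p y +_) (cntL-++ ps (q ∷ qs) y) ⟩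
      cnt p y + (cntL ps y + cntL (q ∷ qs) y)        ≡⟨ +-assoc (cnt p y) _ _ ⟨
      (cnt p y + cntL ps y) + (cnt q y + cntL qs y)  ≡⟨ cong₂ _+_ (cnt-graft-≤ p ps x≤k)
                                                                  (cnt-graft-≤ q qs x≤k) ⟨
      cnt (graft p ps) y + cnt (graft q qs) y        ≡⟨ cong₂ _+_ (lookup-counts (graft p ps) x)
                                                                  (lookup-counts (graft q qs) x) ⟨
      lookup A x + lookup B x                        ≡⟨ lookup-kComb-≤ k A B x≤k ⟨
      lookup (kComb k A B) x                         ∎
      where
      open ≡-Reasoning
      y = toℕ x

  graft-undominated : {T : LTree (Λ I)} (p : LTreeₖ) (ps : List LTreeₖ) (q : LTreeₖ) (qs : List LTreeₖ) →
    AlmostValidAt I (toℕ k) T → Undominated I (counts T) →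
    counts T ≡ kComb k (counts (graft p ps)) (counts (graft q qs)) →
    ℓ′ I (toℕ k) ≤ w (graft p ps) → AllV Boundedₖ (graft q qs) → Undominated I (counts (graft p ps))
  graft-undominated {T} p ps q qs validT undominated T≡ ℓ≤w wbB (_ , (A′ , avA′ , refl) , A′≻A)
    with SingleAbove⇒lift h A′
           (SingleAbove-≤ A′ (graft p ps) (Dominates⇒≤ I A′≻A) (SingleAbove-graft p ps))
  ... | node p′ ps′ , refl = undominated (counts T′ , (T′ , avT′ , refl) , T′≻T)
    where
    T′ = graft p′ (ps′ ++ q ∷ qs)
    T′≻T : Dominates I (counts T′) (counts T)
    T′≻T = subst₂ (Dominates I) (sym (counts-graft-++ p′ ps′ q qs)) (sym T≡)
      (kComb-dominatesˡ I k (counts (graft q qs))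
        (λ x k<x → trans (lookup-counts-graft-> p′ ps′ k<x) (sym (lookup-counts-graft-> p ps k<x))) A′≻A)
    validA′ : AlmostValidAt I (toℕ k) (graft p′ ps′)
    validA′ = AlmostValid⇒AlmostValidAt I N avA′ (SingleAbove-graft p′ ps′) (<⇒≤ (≤′⇒≤ h))
      (subst (ℓ′ I (toℕ k) ≤_) (sym (proj₁ (proj₂ A′≻A))) ℓ≤w)
    wA′ = AllV-graft⁻ p′ ps′ (AlmostValidAt.weightBound validA′)
    wB  = AllV-graft⁻ q qs wbB
    validT′ : AlmostValidAt I (toℕ k) T′
    validT′ = AlmostValidAt-mono I T′ validT (Dominates⇒≤ I T′≻T)
      (AllV-graft⁺ p′ (ps′ ++ q ∷ qs) (proj₁ wA′) (AllVL-++ ps′ (q ∷ qs) (proj₂ wA′) wB))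
    avT′ : AlmostValid I T′
    avT′ = AlmostValidAt⇒AlmostValid I validT′ (SingleAbove-graft p′ (ps′ ++ q ∷ qs))

  graft-paretoOptimal : {T : LTree (Λ I)} (p : LTreeₖ) (ps : List LTreeₖ) (q : LTreeₖ) (qs : List LTreeₖ) →
    AlmostValidAt I (toℕ k) T → Undominated I (counts T) →
    counts T ≡ kComb k (counts (graft p ps)) (counts (graft q qs)) →
    AllV Boundedₖ (graft p ps) → AllV Boundedₖ (graft q qs) → ParetoOptimal I (counts (graft p ps))
  graft-paretoOptimal {T} p ps q qs validT undominated T≡ wbA wbB =
    (A , AlmostValidAt⇒AlmostValid I validA (SingleAbove-graft p ps) , refl) ,
    graft-undominated p ps q qs validT undominated T≡ (graft-weight-≥ p ps wbA) wbB
    where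
    A = graft p ps
    A≤T : Pointwise _≤_ (counts A) (counts T)
    A≤T = subst (Pointwise _≤_ (counts A)) (sym T≡)
      (kComb-≥ˡ k (counts A) (counts (graft q qs)) (SingleAbove⇒AtMostOneAbove A (SingleAbove-graft p ps)))
    validA = AlmostValidAt-mono I A validT A≤T wbA

  graft-paretoSplit : (x y : LTreeₖ) (ys : List LTreeₖ) → AlmostValidAt I (toℕ k) (graft x (y ∷ ys)) →
    Undominated I (counts (graft x (y ∷ ys))) → ParetoSplit I k (counts (graft x (y ∷ ys)))
  graft-paretoSplit x y ys validT undominated =
    counts A , counts B ,
    graft-paretoOptimal x [] y ys validT undominated T≡ wbA wbB ,
    graft-paretoOptimal y ys x [] validT undominated (trans T≡ (kComb-comm k (counts A) (counts B))) wbB wbA ,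
    subst (w A <_) w≡ (m<m+n (w A) (cnt-positive B z≤n)) ,
    subst (w B <_) w≡ (m<n+m (w B) (cnt-positive A z≤n)) ,
    graft-weight-≥ x [] wbA , graft-weight-≥ y ys wbB ,
    branchingLayers , T≡
    where
    A = graft x []
    B = graft y ys
    T≡ : counts (graft x (y ∷ ys)) ≡ kComb k (counts A) (counts B)
    T≡ = counts-graft-++ x [] y ys
    w≡ : w A + w B ≡ w (graft x (y ∷ ys))
    w≡ = sym (trans (cong head T≡) (head-kComb k (counts A) (counts B)))
    wb  = AllV-graft⁻ x (y ∷ ys) (AlmostValidAt.weightBound validT)
    wbA = AllV-graft⁺ x [] (proj₁ wb) tt
    wbB = AllV-graft⁺ y ys (proj₁ (proj₂ wb)) (proj₂ (proj₂ wb))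
    branchingLayers : ∃[ kA ] ∃[ kB ]
      IsBranchingLayer (counts A) kA × IsBranchingLayer (counts B) kB × kA Fin.≤ k × kB Fin.≤ k
    branchingLayers with graft-branchingLayer x [] | graft-branchingLayer y ys
    ... | kA , blA , kA≤k | kB , blB , kB≤k = kA , kB , blA , blB , kA≤k , kB≤k

  paretoSplit : (T : LTree (Λ I)) → AlmostValidAt I (toℕ k) T → SingleAbove (toℕ k) T →
    1 < cnt T (toℕ k) → Undominated I (counts T) → ParetoSplit I k (counts T)
  paretoSplit T validT single 1<Tₖ undominated with SingleAbove⇒lift h T single
  ... | node x []       , refl = contradiction 1<Tₖ (<-irrefl (sym single-child))
    where
    single-child : cnt (graft x []) (toℕ k) ≡ 1
    single-child = trans (cnt-graft-≤ x [] ≤-refl) (trans (+-identityʳ _) (cnt-root x))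
  ... | node x (y ∷ ys) , refl = graft-paretoSplit x y ys validT undominated

lemma4p1 : (I : Instance) → Normalized I →
    (c : Vec ℕ (suc (Λ I))) (k : Fin (suc (Λ I))) →
    ParetoOptimal I c → 2 < head c → IsBranchingLayer c k →
    Σ (Vec ℕ (suc (Λ I))) λ a → Σ (Vec ℕ (suc (Λ I))) λ b →
      ParetoOptimal I a × ParetoOptimal I b ×
      head a < head c × head b < head c ×
      ℓ′ I (toℕ k) ≤ head a × ℓ′ I (toℕ k) ≤ head b ×
      IsKCombination k a b c
lemma4p1 I N .(counts T) k ((T , avT , refl) , undominated) 2<c₀ bl =
  Graft.paretoSplit I N k (≤⇒≤′ k<L) T validT single 1<Tₖ undominated
  where
  validT : AlmostValidAt I (toℕ k) T
  validT = AlmostValid⇒AlmostValidAt-branching I avT bl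
  single : SingleAbove (toℕ k) T
  single = AtMostOneAbove⇒SingleAbove T (proj₁ bl)
  1<Tₖ : 1 < cnt T (toℕ k)
  1<Tₖ = subst (1 <_) (lookup-counts T k) (branchingLayer-nontrivial (counts T) (<⇒≤ 2<c₀) bl)
  k<L : toℕ k < Λ I
  k<L = ≤∧≢⇒< (toℕ≤pred[n] k) λ k≡L → <-irrefl (sym (trans (cong (cnt T) k≡L) (cnt-root T))) 1<Tₖ
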